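{- Let $r\ge0$ be an integer and $\Lambda$ a finite abelian subgroup of $(\mathbb{R}/\mathbb{Z})^{2^{r+2}-1}$ with $\mathrm{wt}(\Lambda)=2^{r+1}$. Let $x_1,\dots,x_{r+2}\in\Lambda$ and let $A$ be the $(r+2)\times(2^{r+2}-1)$ matrix with rows $x_1,\dots,x_{r+2}$. If the support matrix of $A$ equals $A(r+2)$, then $A=M(r+2)$.
   Context: Elements of $(\mathbb{R}/\mathbb{Z})^e$ are written with coordinates in $[0,1)$; $\mathrm{supp}(x)=\{i:x_i\neq0\}$, $\mathrm{wt}(x)=|\mathrm{supp}(x)|$, $\mathrm{wt}(\Lambda)=\max_{x\in\Lambda}\mathrm{wt}(x)$. The support matrix of a matrix with entries in $\mathbb{R}/\mathbb{Z}$ is the $(0,1)$-matrix with entry $0$ where the original entry is $0$ and $1$ otherwise. For $k\ge1$, $A(k)$ is a fixed $k\times(2^k-1)$ $(0,1)$-matrix whose columns are all nonzero vectors of $\{0,1\}^k$, each exactly once, and $M(k)$ is obtained from $A(k)$ by replacing every entry $1$ by $1/2$.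
   Formalization: The subgroup Λ is taken in (ℚ/ℤ)^(2^(r+2)−1) instead of $(\mathbb{R}/\mathbb{Z})^{2^{r+2}-1}$, its elements being represented by rational coordinates in [0,1). -}

module Defs where

open import Data.Bool using (Bool; true; false; not)
open import Data.Nat using (ℕ; _≤_; _^_; _∸_)
open import Data.Fin using (Fin)
open import Data.Vec using (Vec; map; zipWith; replicate; count)
open import Data.List using (List)
open import Data.List.Membership.Propositional using (_∈_)
open import Data.Product using (Σ; ∃; _×_)
open import Data.Rational using (ℚ; 0ℚ; 1ℚ; ½; _+_; _-_; -_; floor; _/_; _<_) renaming (_≤_ to _≤ℚ_)
open import Data.Rational.Properties using (_≟_)
open import Relation.Nullary using (¬_; does; ¬?)
open import Relation.Binary.PropositionalEquality using (_≡_)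

-- Elements of ℝ/ℤ of finite order are rational; we represent an element of
-- (ℝ/ℤ)^e lying in a finite subgroup by its vector of representatives in [0,1).

mod1 : ℚ → ℚ
mod1 q = q - (floor q / 1)

Normalised : ℚ → Set
Normalised q = (0ℚ ≤ℚ q) × (q < 1ℚ)

_⊕_ : {e : ℕ} → Vec ℚ e → Vec ℚ e → Vec ℚ e
x ⊕ y = zipWith (λ a b → mod1 (a + b)) x y

⊖_ : {e : ℕ} → Vec ℚ e → Vec ℚ e
⊖ x = map (λ a → mod1 (- a)) x

zeroV : {e : ℕ} → Vec ℚ e
zeroV = replicate _ 0ℚ

IsFiniteSubgroup : {e : ℕ} → List (Vec ℚ e) → Set
IsFiniteSubgroup {e} Λ =
  (∀ x → x ∈ Λ → ∀ i → Normalised (Data.Vec.lookup x i)) ×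
  (zeroV ∈ Λ) ×
  (∀ x y → x ∈ Λ → y ∈ Λ → (x ⊕ y) ∈ Λ) ×
  (∀ x → x ∈ Λ → (⊖ x) ∈ Λ)

suppBit : ℚ → Bool
suppBit q = not (does (q ≟ 0ℚ))

wt : {e : ℕ} → Vec ℚ e → ℕ
wt x = count (λ q → ¬? (q ≟ 0ℚ)) x

WtEq : {e : ℕ} → List (Vec ℚ e) → ℕ → Set
WtEq Λ w = (∀ x → x ∈ Λ → wt x ≤ w) × (∃ λ x → x ∈ Λ × wt x ≡ w)

-- P is (a choice of) A(k): a k × (2^k - 1) (0,1)-matrix (Bool entries, true = 1)
-- whose columns are all nonzero vectors of {0,1}^k, each exactly once.
IsA : (k : ℕ) → (Fin k → Fin (2 ^ k ∸ 1) → Bool) → Set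
IsA k P =
  (∀ j → ∃ λ i → P i j ≡ true) ×
  (∀ j j' → (∀ i → P i j ≡ P i j') → j ≡ j') ×
  (∀ (v : Fin k → Bool) → (∃ λ i → v i ≡ true) → ∃ λ j → ∀ i → P i j ≡ v i)

toM : Bool → ℚ
toM true = ½
toM false = 0ℚ

-- For distinct rows i, i′ of A(r+2) and
-- h : Bool → Bool with h false = true, the columns in which row i equals h (row i′) are 2^(r+1) in
-- number, so a vector of Λ that is nonzero in all of them vanishes in every other column.
-- Let a = (x_i)_j ∈ (0,1) where A_ij = 1, and pick i′ ≠ i.
-- If A_i′j = 1, let b = (x_i′)_j ∈ (0,1). Then x_i ± x_i′ is nonzero wherever exactly one of the
-- rows i, i′ has a 1 (h = not), so a + b ≡ a − b ≡ 0 (mod 1), which forces a = ½.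
-- If A_i′j = 0, then 2x_i + x_i′ is nonzero wherever row i′ has a 1 (h = const true), its entry
-- there being 3/2 by the first case or (x_i′)_j; so 2a ≡ 0 (mod 1) and again a = ½.
module Submission where

open import Defs

open import Data.Bool using (Bool; true; false; not)
open import Data.Fin using (Fin; zero; suc; punchIn; punchOut)
open import Data.Fin.Properties using (punchIn-punchOut; punchInᵢ≢i)
open import Data.List using (List; []; _∷_; length; map; _++_; cartesianProductWith)
open import Data.List.Membership.Propositional using (_∈_)
open import Data.List.Properties using (length-++; length-map)
open import Data.List.Relation.Unary.All as All using (All; []; _∷_)
import Data.List.Relation.Unary.All.Properties as All
open import Data.List.Relation.Unary.AllPairs using ([]; _∷_)
open import Data.List.Relation.Unary.Unique.Propositional using (Unique)
import Data.List.Relation.Unary.Unique.Propositional.Properties as Unique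
open import Data.Nat using (ℕ; zero; suc; z≤n; s≤s; _^_)
import Data.Nat as ℕ
import Data.Nat.Properties as ℕ
open import Data.Product using (∃; _×_; _,_; proj₁; proj₂)
open import Data.Rational using (ℚ; 0ℚ; ½)
open import Data.Rational.Properties using (_≟_)
open import Data.Vec using (Vec; []; _∷_; lookup; count; _[_]≔_; insertAt; tabulate)
open import Data.Vec.Properties
  using (lookup∘update′; ∷-injective; insertAt-lookup; insertAt-punchIn; tabulate∘lookup; tabulate-cong)
open import Function using (_∘_; case_of_)
open import Relation.Binary.PropositionalEquality
open import Relation.Nullary using (¬_; does; yes; no)
open import Relation.Nullary.Decidable using (dec-true; dec-false; decidable-stable)
open import Relation.Unary using (Pred; Decidable)

module ℚ/ℤ where

  open import Algebra.Properties.Group Data.Rational.Properties.+-0-group using (x∙y⁻¹≈ε⇒x≈y)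
  open import Data.Integer as ℤ using (+0; +[1+_]; -[1+_])
  import Data.Integer.Properties as ℤ
  open import Data.Integer.GCD using (gcd)
  open import Data.Rational using (mkℚ; 1ℚ; _+_; _*_; _-_; -_; _/_; _≤_; _<_; *<*; ↧_; ↧ₙ_; floor)
  open import Data.Rational.Properties
    using (↧-/; ↧-neg; +-inverseʳ; +-mono-<; +-mono-≤-<; +-mono-<-≤; <⇒≤; neg-antimono-<; neg-antimono-≤;
           _<?_; ≤-antisym; ≮⇒≥)
  open import Data.Rational.Solver using (module +-*-Solver)
  open import Data.Vec.Properties using (lookup-zipWith; lookup-map)

  -- A record rather than the bare equation, so that q can be inferred from Integral q.
  record Integral (q : ℚ) : Set where
    constructor integral
    field denominator≡1 : ↧ₙ q ≡ 1

  integral-/1 : ∀ k → Integral (k / 1)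
  integral-/1 k = integral (ℕ.m*n≡1⇒m≡1 (↧ₙ (k / 1)) _
    (trans (sym (ℤ.abs-* (↧ (k / 1)) (gcd k (ℤ.+ 1)))) (cong ℤ.∣_∣ (↧-/ k 1))))

  integral-+ : ∀ {p q} → Integral p → Integral q → Integral (p + q)
  integral-+ {mkℚ k 0 _} {mkℚ l 0 _} (integral refl) (integral refl) = integral-/1 (k ℤ.* ℤ.1ℤ ℤ.+ l ℤ.* ℤ.1ℤ)

  neg-integral⇒integral : ∀ {q} → Integral (- q) → Integral q
  neg-integral⇒integral {q} (integral ↧ₙ-q≡1) = integral (trans (cong ℤ.∣_∣ (sym (↧-neg q))) ↧ₙ-q≡1)

  mod1≡0⇒integral : ∀ {q} → mod1 q ≡ 0ℚ → Integral q
  mod1≡0⇒integral {q} q-⌊q⌋≡0 = subst Integral (sym (x∙y⁻¹≈ε⇒x≈y q _ q-⌊q⌋≡0)) (integral-/1 (floor q))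

  integral-+mod1 : ∀ p q → Integral (p + mod1 q) → Integral (p + q)
  integral-+mod1 p q ∫ =
    subst Integral (sym (p+q≡p+[q-f]+f p q (floor q / 1))) (integral-+ ∫ (integral-/1 (floor q)))
    where
    open +-*-Solver
    p+q≡p+[q-f]+f : ∀ p q f → p + q ≡ (p + (q - f)) + f
    p+q≡p+[q-f]+f = solve 3 (λ p q f → p :+ q := (p :+ (q :- f)) :+ f) refl

  InOpenUnit : ℚ → Set
  InOpenUnit a = 0ℚ < a × a < 1ℚ

  0≤q∧q≢0⇒0<q : ∀ {q} → 0ℚ ≤ q → q ≢ 0ℚ → 0ℚ < q
  0≤q∧q≢0⇒0<q {q} 0≤q q≢0 = decidable-stable (0ℚ <? q) (λ 0≮q → q≢0 (≤-antisym (≮⇒≥ 0≮q) 0≤q))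

  inOpenUnit⇒¬integral : ∀ {q} → InOpenUnit q → ¬ Integral q
  inOpenUnit⇒¬integral {mkℚ +0       0 _} (*<* (ℤ.+<+ ()) , _) (integral refl)
  inOpenUnit⇒¬integral {mkℚ +[1+ _ ] 0 _} (_ , *<* (ℤ.+<+ (ℕ.s≤s ()))) (integral refl)
  inOpenUnit⇒¬integral {mkℚ -[1+ _ ] 0 _} (*<* () , _) (integral refl)

  integral∧-1<q<1⇒q≡0 : ∀ {q} → Integral q → - 1ℚ < q → q < 1ℚ → q ≡ 0ℚ
  integral∧-1<q<1⇒q≡0 {mkℚ +0       0 _} (integral refl) _ _ = refl
  integral∧-1<q<1⇒q≡0 {mkℚ +[1+ _ ] 0 _} (integral refl) _ (*<* (ℤ.+<+ (ℕ.s≤s ())))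
  integral∧-1<q<1⇒q≡0 {mkℚ -[1+ _ ] 0 _} (integral refl) (*<* (ℤ.-<- ())) _

  integral∧0<q<2⇒q≡1 : ∀ {q} → Integral q → 0ℚ < q → q < 1ℚ + 1ℚ → q ≡ 1ℚ
  integral∧0<q<2⇒q≡1 {mkℚ +0                0 _} (integral refl) (*<* (ℤ.+<+ ())) _
  integral∧0<q<2⇒q≡1 {mkℚ +[1+ 0 ]          0 _} (integral refl) _ _ = refl
  integral∧0<q<2⇒q≡1 {mkℚ +[1+ ℕ.suc _ ]    0 _} (integral refl) _ (*<* (ℤ.+<+ (ℕ.s≤s (ℕ.s≤s ()))))
  integral∧0<q<2⇒q≡1 {mkℚ -[1+ _ ]          0 _} (integral refl) (*<* ()) _

  integral-sum∧difference⇒½ : ∀ {a b} → InOpenUnit a → InOpenUnit b →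
    Integral (a + b) → Integral (a - b) → a ≡ ½
  integral-sum∧difference⇒½ {a} {b} (0<a , a<1) (0<b , b<1) ∫a+b ∫a-b = begin
    a                         ≡⟨ a≡½[[a+b]+[a-b]] a b ⟩
    ½ * ((a + b) + (a - b))   ≡⟨ cong₂ (λ s d → ½ * (s + d)) a+b≡1 a-b≡0 ⟩
    ½ * (1ℚ + 0ℚ)             ≡⟨⟩
    ½                         ∎
    where
    open ≡-Reasoning
    open +-*-Solver
    a≡½[[a+b]+[a-b]] : ∀ a b → a ≡ ½ * ((a + b) + (a - b))
    a≡½[[a+b]+[a-b]] = solve 2 (λ a b → a := con ½ :* ((a :+ b) :+ (a :- b))) refl
    a+b≡1 : a + b ≡ 1ℚ
    a+b≡1 = integral∧0<q<2⇒q≡1 ∫a+b (+-mono-< 0<a 0<b) (+-mono-< a<1 b<1)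
    a-b≡0 : a - b ≡ 0ℚ
    a-b≡0 = integral∧-1<q<1⇒q≡0 ∫a-b
      (+-mono-≤-< (<⇒≤ 0<a) (neg-antimono-< b<1))
      (+-mono-<-≤ a<1 (neg-antimono-≤ (<⇒≤ 0<b)))

  integral-double⇒½ : ∀ {a} → InOpenUnit a → Integral (a + a) → a ≡ ½
  integral-double⇒½ {a} a∈I ∫2a =
    integral-sum∧difference⇒½ a∈I a∈I ∫2a (subst Integral (sym (+-inverseʳ a)) (integral refl))

  ⊕-vanishes⇒integral : ∀ {n} (x y : Vec ℚ n) j →
    lookup (x ⊕ y) j ≡ 0ℚ → Integral (lookup x j + lookup y j)
  ⊕-vanishes⇒integral x y j x⊕y≡0 = mod1≡0⇒integral (trans (sym (lookup-zipWith _ j x y)) x⊕y≡0)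

  ⊖-vanishes⇒integral : ∀ {n} (x y : Vec ℚ n) j →
    lookup (x ⊕ (⊖ y)) j ≡ 0ℚ → Integral (lookup x j - lookup y j)
  ⊖-vanishes⇒integral x y j x⊖y≡0 = integral-+mod1 (lookup x j) (- lookup y j)
    (subst (λ t → Integral (lookup x j + t)) (lookup-map j _ y) (⊕-vanishes⇒integral x (⊖ y) j x⊖y≡0))

  ⊕⊕-vanishes⇒integral : ∀ {n} (x y : Vec ℚ n) j →
    lookup (x ⊕ (x ⊕ y)) j ≡ 0ℚ → Integral (lookup x j + (lookup x j + lookup y j))
  ⊕⊕-vanishes⇒integral x y j x⊕x⊕y≡0 = integral-+mod1 (lookup x j) (lookup x j + lookup y j)
    (subst (λ t → Integral (lookup x j + t)) (lookup-zipWith _ j x y)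
           (⊕-vanishes⇒integral x (x ⊕ y) j x⊕x⊕y≡0))

open ℚ/ℤ

count-[]≔ : ∀ {a p} {A : Set a} {P : Pred A p} (P? : Decidable P) {n} (xs : Vec A n) i {y} →
  P (lookup xs i) → ¬ P y → count P? xs ≡ suc (count P? (xs [ i ]≔ y))
count-[]≔ P? (x ∷ xs) zero    {y} px ¬py rewrite dec-true (P? x) px | dec-false (P? y) ¬py = refl
count-[]≔ P? (x ∷ xs) (suc i)     px ¬py with does (P? x)
... | true  = cong suc (count-[]≔ P? xs i px ¬py)
... | false = count-[]≔ P? xs i px ¬py

unique∧nonzero⇒length≤wt : ∀ {n} (z : Vec ℚ n) {js} → Unique js →
  All (λ j → lookup z j ≢ 0ℚ) js → length js ℕ.≤ wt z
unique∧nonzero⇒length≤wt z [] [] = z≤n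
unique∧nonzero⇒length≤wt z {j ∷ js} (j∉js ∷ unique) (zj≢0 ∷ nonzero) = begin
  suc (length js)         ≤⟨ s≤s (unique∧nonzero⇒length≤wt (z [ j ]≔ 0ℚ) unique nonzero′) ⟩
  suc (wt (z [ j ]≔ 0ℚ))  ≡⟨ count-[]≔ _ z j zj≢0 (λ 0≢0 → 0≢0 refl) ⟨
  wt z                    ∎
  where
  open ℕ.≤-Reasoning
  nonzero′ : All (λ j′ → lookup (z [ j ]≔ 0ℚ) j′ ≢ 0ℚ) js
  nonzero′ = All.zipWith (λ (j≢j′ , zj′≢0) → zj′≢0 ∘ trans (sym (lookup∘update′ (j≢j′ ∘ sym) z 0ℚ)))
                         (j∉js , nonzero)

allBoolVecs : ∀ k → List (Vec Bool k)
allBoolVecs zero    = [] ∷ []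
allBoolVecs (suc k) = cartesianProductWith _∷_ (false ∷ true ∷ []) (allBoolVecs k)

allBoolVecs-unique : ∀ k → Unique (allBoolVecs k)
allBoolVecs-unique zero    = [] ∷ []
allBoolVecs-unique (suc k) =
  Unique.cartesianProductWith⁺ _∷_ ∷-injective (((λ ()) ∷ []) ∷ [] ∷ []) (allBoolVecs-unique k)

length-allBoolVecs : ∀ k → length (allBoolVecs k) ≡ 2 ^ k
length-allBoolVecs zero    = refl
length-allBoolVecs (suc k) = begin
  length (map (false ∷_) vs ++ map (true ∷_) vs ++ [])
    ≡⟨ length-++ (map (false ∷_) vs) ⟩
  length (map (false ∷_) vs) ℕ.+ length (map (true ∷_) vs ++ [])
    ≡⟨ cong₂ ℕ._+_ (length-map _ vs) (trans (length-++ (map (true ∷_) vs)) (cong (ℕ._+ 0) (length-map _ vs))) ⟩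
  length vs ℕ.+ (length vs ℕ.+ 0)
    ≡⟨ cong (λ l → l ℕ.+ (l ℕ.+ 0)) (length-allBoolVecs k) ⟩
  2 ^ k ℕ.+ (2 ^ k ℕ.+ 0) ∎
  where
  open ≡-Reasoning
  vs : List (Vec Bool k)
  vs = allBoolVecs k

-- The columns on which row i is h of row i′ are indexed by the values u of the other k rows; since
-- h false ≡ true every such pattern is nonzero, hence (by surj) the pattern of some column.
module Graph {k n : ℕ} (P : Fin (suc k) → Fin n → Bool)
  (surj : ∀ (v : Fin (suc k) → Bool) → (∃ λ l → v l ≡ true) → ∃ λ j → ∀ l → P l j ≡ v l)
  {i i′ : Fin (suc k)} (i≢i′ : i ≢ i′) (h : Bool → Bool) (h-false : h false ≡ true) where

  OnGraph : Fin n → Set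
  OnGraph j = P i j ≡ h (P i′ j)

  private
    l′ : Fin k
    l′ = punchOut i≢i′

  graphPattern : Vec Bool k → Vec Bool (suc k)
  graphPattern u = insertAt u i (h (lookup u l′))

  graphPattern-nonzero : ∀ u → ∃ λ l → lookup (graphPattern u) l ≡ true
  graphPattern-nonzero u with lookup u l′ in ul′≡
  ... | true  = punchIn i l′ , trans (insertAt-punchIn u i _ l′) ul′≡
  ... | false = i , trans (insertAt-lookup u i _) h-false

  graphColumn : Vec Bool k → Fin n
  graphColumn u = proj₁ (surj (lookup (graphPattern u)) (graphPattern-nonzero u))

  graphColumn-pattern : ∀ u l → P l (graphColumn u) ≡ lookup (graphPattern u) l
  graphColumn-pattern u = proj₂ (surj (lookup (graphPattern u)) (graphPattern-nonzero u))

  graphColumn-punchIn : ∀ u l → P (punchIn i l) (graphColumn u) ≡ lookup u l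
  graphColumn-punchIn u l = trans (graphColumn-pattern u (punchIn i l)) (insertAt-punchIn u i _ l)

  graphColumn-onGraph : ∀ u → OnGraph (graphColumn u)
  graphColumn-onGraph u = begin
    P i (graphColumn u)                   ≡⟨ graphColumn-pattern u i ⟩
    lookup (graphPattern u) i             ≡⟨ insertAt-lookup u i _ ⟩
    h (lookup u l′)                       ≡⟨ cong h (graphColumn-punchIn u l′) ⟨
    h (P (punchIn i l′) (graphColumn u))  ≡⟨ cong (λ i″ → h (P i″ (graphColumn u))) (punchIn-punchOut i≢i′) ⟩
    h (P i′ (graphColumn u))              ∎
    where open ≡-Reasoning

  graphColumn-injective : ∀ {u w} → graphColumn u ≡ graphColumn w → u ≡ w
  graphColumn-injective {u} {w} same = begin
    u                    ≡⟨ tabulate∘lookup u ⟨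
    tabulate (lookup u)  ≡⟨ tabulate-cong u≗w ⟩
    tabulate (lookup w)  ≡⟨ tabulate∘lookup w ⟩
    w                    ∎
    where
    open ≡-Reasoning
    u≗w : ∀ l → lookup u l ≡ lookup w l
    u≗w l = trans (sym (graphColumn-punchIn u l))
                  (trans (cong (P (punchIn i l)) same) (graphColumn-punchIn w l))

  graphColumns : List (Fin n)
  graphColumns = map graphColumn (allBoolVecs k)

  2^k<wt : ∀ (z : Vec ℚ n) → (∀ j → OnGraph j → lookup z j ≢ 0ℚ) →
    ∀ {j} → ¬ OnGraph j → lookup z j ≢ 0ℚ → 2 ^ k ℕ.< wt z
  2^k<wt z nonzero-on {j} off zj≢0 =
    subst (λ l → l ℕ.< wt z) (trans (length-map graphColumn (allBoolVecs k)) (length-allBoolVecs k))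
      (unique∧nonzero⇒length≤wt z (j∉graphColumns ∷ Unique.map⁺ graphColumn-injective (allBoolVecs-unique k))
                                  (zj≢0 ∷ All.map (nonzero-on _) onGraph))
    where
    onGraph : All OnGraph graphColumns
    onGraph = All.map⁺ (All.tabulate (λ {u} _ → graphColumn-onGraph u))
    j∉graphColumns : All (j ≢_) graphColumns
    j∉graphColumns = All.map (λ on j≡ → off (subst OnGraph (sym j≡) on)) onGraph

module Entries {m n : ℕ} {Λ : List (Vec ℚ n)}
  (normalised : ∀ z → z ∈ Λ → ∀ j → Normalised (lookup z j))
  (⊕-closed : ∀ y z → y ∈ Λ → z ∈ Λ → (y ⊕ z) ∈ Λ)
  (⊖-closed : ∀ z → z ∈ Λ → (⊖ z) ∈ Λ)
  (wt≤ : ∀ z → z ∈ Λ → wt z ℕ.≤ 2 ^ suc m)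
  {P : Fin (suc (suc m)) → Fin n → Bool}
  (surj : ∀ (v : Fin (suc (suc m)) → Bool) → (∃ λ l → v l ≡ true) → ∃ λ j → ∀ l → P l j ≡ v l)
  {x : Fin (suc (suc m)) → Vec ℚ n} (x∈Λ : ∀ i → x i ∈ Λ)
  (supp : ∀ i j → suppBit (lookup (x i) j) ≡ P i j) where

  open import Data.Rational using (_+_; _-_)
  open import Data.Rational.Properties using (+-identityˡ; +-identityʳ)

  vanishes-off-graph : ∀ {z} → z ∈ Λ → ∀ {i i′} → i ≢ i′ → ∀ h → h false ≡ true →
    (∀ j → P i j ≡ h (P i′ j) → lookup z j ≢ 0ℚ) → ∀ j → P i j ≢ h (P i′ j) → lookup z j ≡ 0ℚ
  vanishes-off-graph {z} z∈Λ i≢i′ h h-false nonzero-on j off =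
    decidable-stable (lookup z j ≟ 0ℚ) (λ zj≢0 → ℕ.<⇒≱ (2^k<wt z nonzero-on off zj≢0) (wt≤ z z∈Λ))
    where open Graph P surj i≢i′ h h-false

  entry-zero : ∀ {i j} → P i j ≡ false → lookup (x i) j ≡ 0ℚ
  entry-zero {i} {j} Pij≡false with lookup (x i) j ≟ 0ℚ | supp i j
  ... | yes xij≡0 | _        = xij≡0
  ... | no _      | true≡Pij = case trans true≡Pij Pij≡false of λ ()

  entry-unit : ∀ {i j} → P i j ≡ true → InOpenUnit (lookup (x i) j)
  entry-unit {i} {j} Pij≡true = 0≤q∧q≢0⇒0<q (proj₁ xij-normalised) xij≢0 , proj₂ xij-normalised
    where
    xij-normalised : Normalised (lookup (x i) j)
    xij-normalised = normalised _ (x∈Λ i) j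
    xij≢0 : lookup (x i) j ≢ 0ℚ
    xij≢0 xij≡0 = case trans (sym (cong suppBit xij≡0)) (trans (supp i j) Pij≡true) of λ ()

  both-one⇒entry≡½ : ∀ {i i′ j} → i ≢ i′ → P i j ≡ true → P i′ j ≡ true → lookup (x i) j ≡ ½
  both-one⇒entry≡½ {i} {i′} {j} i≢i′ Pij Pi′j =
    integral-sum∧difference⇒½ (entry-unit Pij) (entry-unit Pi′j) ∫sum ∫difference
    where
    exactly-one : ∀ {j′} → P i j′ ≡ not (P i′ j′) →
      ¬ Integral (lookup (x i) j′ + lookup (x i′) j′) × ¬ Integral (lookup (x i) j′ - lookup (x i′) j′)
    exactly-one {j′} on with P i′ j′ in Pi′j′
    ... | true  rewrite entry-zero on =
          ¬∫b ∘ subst Integral (+-identityˡ _) , ¬∫b ∘ neg-integral⇒integral ∘ subst Integral (+-identityˡ _)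
      where
      ¬∫b : ¬ Integral (lookup (x i′) j′)
      ¬∫b = inOpenUnit⇒¬integral (entry-unit Pi′j′)
    ... | false rewrite entry-zero Pi′j′ =
          ¬∫a ∘ subst Integral (+-identityʳ _) , ¬∫a ∘ subst Integral (+-identityʳ _)
      where
      ¬∫a : ¬ Integral (lookup (x i) j′)
      ¬∫a = inOpenUnit⇒¬integral (entry-unit on)
    off : P i j ≢ not (P i′ j)
    off on = case trans (sym Pij) (trans on (cong not Pi′j)) of λ ()
    ∫sum : Integral (lookup (x i) j + lookup (x i′) j)
    ∫sum = ⊕-vanishes⇒integral (x i) (x i′) j
      (vanishes-off-graph (⊕-closed _ _ (x∈Λ i) (x∈Λ i′)) i≢i′ not refl
        (λ j′ on → proj₁ (exactly-one on) ∘ ⊕-vanishes⇒integral (x i) (x i′) j′) j off)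
    ∫difference : Integral (lookup (x i) j - lookup (x i′) j)
    ∫difference = ⊖-vanishes⇒integral (x i) (x i′) j
      (vanishes-off-graph (⊕-closed _ _ (x∈Λ i) (⊖-closed _ (x∈Λ i′))) i≢i′ not refl
        (λ j′ on → proj₂ (exactly-one on) ∘ ⊖-vanishes⇒integral (x i) (x i′) j′) j off)

  one-zero⇒entry≡½ : ∀ {i i′ j} → i ≢ i′ → P i j ≡ true → P i′ j ≡ false → lookup (x i) j ≡ ½
  one-zero⇒entry≡½ {i} {i′} {j} i≢i′ Pij Pi′j = integral-double⇒½ (entry-unit Pij) ∫2a
    where
    z∈Λ : x i ⊕ (x i ⊕ x i′) ∈ Λ
    z∈Λ = ⊕-closed _ _ (x∈Λ i) (⊕-closed _ _ (x∈Λ i) (x∈Λ i′))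
    ¬∫3/2 : ¬ Integral (½ + (½ + ½))
    ¬∫3/2 (integral ())
    nonzero-on : ∀ j′ → P i′ j′ ≡ true → lookup (x i ⊕ (x i ⊕ x i′)) j′ ≢ 0ℚ
    nonzero-on j′ Pi′j′ with P i j′ in Pij′
    ... | true  = ¬∫3/2
                ∘ subst₂ (λ a b → Integral (a + (a + b)))
                    (both-one⇒entry≡½ i≢i′ Pij′ Pi′j′) (both-one⇒entry≡½ (i≢i′ ∘ sym) Pi′j′ Pij′)
                ∘ ⊕⊕-vanishes⇒integral (x i) (x i′) j′
    ... | false = inOpenUnit⇒¬integral (entry-unit Pi′j′)
                ∘ subst Integral (trans (+-identityˡ _) (+-identityˡ _))
                ∘ subst (λ a → Integral (a + (a + lookup (x i′) j′))) (entry-zero Pij′)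
                ∘ ⊕⊕-vanishes⇒integral (x i) (x i′) j′
    off : P i′ j ≢ true
    off on = case trans (sym Pi′j) on of λ ()
    a+b≡a : lookup (x i) j + lookup (x i′) j ≡ lookup (x i) j
    a+b≡a = trans (cong (lookup (x i) j +_) (entry-zero Pi′j)) (+-identityʳ _)
    ∫2a : Integral (lookup (x i) j + lookup (x i) j)
    ∫2a = subst (λ b → Integral (lookup (x i) j + b)) a+b≡a
            (⊕⊕-vanishes⇒integral (x i) (x i′) j
              (vanishes-off-graph z∈Λ (i≢i′ ∘ sym) (λ _ → true) refl nonzero-on j off))

  entry≡toM : ∀ i j → lookup (x i) j ≡ toM (P i j)
  entry≡toM i j with P i j in Pij | P (punchIn i zero) j in Pi′j
  ... | false | _     = entry-zero Pij
  ... | true  | true  = both-one⇒entry≡½ (punchInᵢ≢i i zero ∘ sym) Pij Pi′j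
  ... | true  | false = one-zero⇒entry≡½ (punchInᵢ≢i i zero ∘ sym) Pij Pi′j

open import Data.Nat using (_+_; _∸_)

-- r + 2 and r + 1 are not definitionally suc (suc r) and suc r.
lemma3p2 : (r : ℕ) (Λ : List (Vec ℚ (2 ^ (r + 2) ∸ 1))) →
    IsFiniteSubgroup Λ → WtEq Λ (2 ^ (r + 1)) →
    (P : Fin (r + 2) → Fin (2 ^ (r + 2) ∸ 1) → Bool) → IsA (r + 2) P →
    (x : Fin (r + 2) → Vec ℚ (2 ^ (r + 2) ∸ 1)) → (∀ i → x i ∈ Λ) →
    (∀ i j → suppBit (lookup (x i) j) ≡ P i j) →
    ∀ i j → lookup (x i) j ≡ toM (P i j)
lemma3p2 r with r + 2 | ℕ.+-comm r 2 | r + 1 | ℕ.+-comm r 1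
... | _ | refl | _ | refl =
  λ Λ (normalised , _ , ⊕-closed , ⊖-closed) (wt≤ , _) P (_ , _ , surj) x x∈Λ supp →
    Entries.entry≡toM normalised ⊕-closed ⊖-closed wt≤ surj x∈Λ supp
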